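{- For every $n\ge 1$, the map $f:G_n\to L_n$ defined by $f(A)=[n-1]\setminus A$ is well defined and is a bijection.
   Context: $[n-1]=\{1,\dots,n-1\}$. $G_n$ is the set of subsets $A=\{a_1<\dots<a_\ell\}\subseteq[n-1]$ (including the empty set) such that $a_i+a_{\ell-i+1}\ge n$ for all $i\in[\ell]$; $L_n$ is the set of subsets $A=\{a_1<\dots<a_\ell\}\subseteq[n-1]$ such that $a_i+a_{\ell-i+1}\le n$ for all $i\in[\ell]$. -}

module Defs where

open import Data.Nat using (ℕ; suc; _+_; _∸_; _≤_; _<_)
open import Data.Nat.Properties using (_≟_)
open import Data.Fin using (Fin; opposite)
open import Data.List using (List; length; lookup; map; upTo; filter)
open import Data.List.Relation.Unary.All using (All)
open import Data.List.Relation.Unary.Linked using (Linked)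
open import Data.List.Membership.DecPropositional _≟_ using (_∉?_)
open import Data.Product using (_×_)

range : ℕ → List ℕ
range n = map suc (upTo (n ∸ 1))

-- A subset of [n-1] is represented by the strictly increasing list
-- a₁ < a₂ < ... < a_ℓ of its elements, each in [n-1].
IsSubsetOf[n-1] : ℕ → List ℕ → Set
IsSubsetOf[n-1] n A = Linked _<_ A × All (λ a → 1 ≤ a × a < n) A

-- G_n : a_i + a_{ℓ-i+1} ≥ n for all i  (0-based: index i paired with ℓ-1-i = opposite i)
InG : ℕ → List ℕ → Set
InG n A = IsSubsetOf[n-1] n A
        × ((i : Fin (length A)) → n ≤ lookup A i + lookup A (opposite i))

InL : ℕ → List ℕ → Set
InL n A = IsSubsetOf[n-1] n A
        × ((i : Fin (length A)) → lookup A i + lookup A (opposite i) ≤ n)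

compl : ℕ → List ℕ → List ℕ
compl n A = filter (_∉? A) (range n)

module Submission where

-- For a strictly increasing list A, the entries ≤ p form an initial segment of
-- length countLE p A (the number of entries ≤ p).  This turns the pairing conditions
-- into counting conditions over the splittings p + q = j:
--   A ∈ G_n  ⇔  countLE p A + countLE q A ≤ |A|      (GCount),
--   A ∈ L_n  ⇔  |A| ≤ countLE p A + countLE q A      (LCount).
-- If A ⊆ [n-1] = {1,…,j} and C = [n-1] ∖ A, then countLE p A + countLE p C = p for p ≤ j
-- and |A| + |C| = j, so the four counts of A and C at (p, q) sum to |A| + |C|, and
-- GCount for A is exactly LCount for C.  Finally f is an involution on subsets of
-- [n-1] (strictly increasing lists are determined by their members), which gives
-- injectivity and, with the duality applied to C = f(B), surjectivity.

open import Defs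
open import Data.Nat using (ℕ; zero; suc; _+_; _∸_; _≤_; _<_; z≤n; s≤s; s≤s⁻¹; z<s; s<s; s<s⁻¹)
open import Data.Nat.Properties
open import Data.Fin using (Fin; toℕ; fromℕ<; opposite) renaming (zero to fzero; suc to fsuc)
open import Data.Fin.Properties using (toℕ<n; toℕ-fromℕ<; opposite-prop)
open import Data.List using (List; []; _∷_; length; lookup; applyUpTo; filter)
open import Data.List.Properties using (length-filter; filter-none; filter-all; map-upTo; length-applyUpTo; lookup-applyUpTo)
open import Data.List.Relation.Unary.All as All using (All; []; _∷_)
import Data.List.Relation.Unary.All.Properties as All
open import Data.List.Relation.Unary.Any using (here; there)
open import Data.List.Relation.Unary.Linked as Linked using (Linked; []; [-]; _∷_)
import Data.List.Relation.Unary.Linked.Properties as Linked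
open import Data.List.Membership.Propositional using (_∈_; _∉_)
open import Data.List.Membership.Propositional.Properties using (∈-lookup; ∈-filter⁺; ∈-filter⁻; ∈-applyUpTo⁺)
open import Data.List.Membership.DecPropositional _≟_ using (_∈?_; _∉?_)
open import Data.Product using (_×_; _,_; proj₁; proj₂; ∃; ∃₂)
open import Data.Bool using (true; false)
open import Relation.Nullary using (¬_; yes; no; does; contradiction)
open import Relation.Unary using (Pred; Decidable)
open import Relation.Unary.Properties using (∁?)
open import Relation.Binary.PropositionalEquality using (_≡_; refl; sym; trans; cong; cong₂; subst; subst₂; module ≡-Reasoning)
open import Algebra.Properties.CommutativeSemigroup +-commutativeSemigroup using (interchange)
open import Level using (0ℓ)

head-below : ∀ {x xs} → Linked _<_ (x ∷ xs) → All (x <_) xs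
head-below [-] = []
head-below (x<y ∷ s) = Linked.Linked⇒All <-trans x<y s

head-≤ : ∀ {x xs z} → Linked _<_ (x ∷ xs) → z ∈ x ∷ xs → x ≤ z
head-≤ _ (here refl) = ≤-refl
head-≤ s (there z∈xs) = <⇒≤ (All.lookup (head-below s) z∈xs)

drop-head : ∀ {x xs ys z} → Linked _<_ (x ∷ xs) → z ∈ xs → z ∈ x ∷ ys → z ∈ ys
drop-head s z∈xs (here refl) = contradiction (All.lookup (head-below s) z∈xs) (<-irrefl refl)
drop-head _ _ (there z∈ys) = z∈ys

sorted-ext : ∀ {xs ys} → Linked _<_ xs → Linked _<_ ys →
             (∀ {z} → z ∈ xs → z ∈ ys) → (∀ {z} → z ∈ ys → z ∈ xs) → xs ≡ ys
sorted-ext {[]} {[]} _ _ _ _ = refl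
sorted-ext {[]} {_ ∷ _} _ _ _ ys⊆xs with ys⊆xs (here refl)
... | ()
sorted-ext {_ ∷ _} {[]} _ _ xs⊆ys _ with xs⊆ys (here refl)
... | ()
sorted-ext {x ∷ xs} {y ∷ ys} sx sy xs⊆ys ys⊆xs
  with ≤-antisym (head-≤ sy (xs⊆ys (here refl))) (head-≤ sx (ys⊆xs (here refl)))
... | refl = cong (x ∷_) (sorted-ext (Linked.tail sx) (Linked.tail sy)
                           (λ z∈xs → drop-head sx z∈xs (xs⊆ys (there z∈xs)))
                           (λ z∈ys → drop-head sy z∈ys (ys⊆xs (there z∈ys))))

filter-characterisation : ∀ {P : Pred ℕ 0ℓ} (P? : Decidable P) {U A} →
  Linked _<_ U → Linked _<_ A →
  (∀ {x} → x ∈ A → x ∈ U × P x) → (∀ {x} → x ∈ U → P x → x ∈ A) →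
  filter P? U ≡ A
filter-characterisation P? {U} sU sA A⊆ ⊆A =
  sorted-ext (Linked.filter⁺ P? <-trans sU) sA
    (λ x∈ → let (x∈U , Px) = ∈-filter⁻ P? x∈ in ⊆A x∈U Px)
    (λ x∈A → let (x∈U , Px) = A⊆ x∈A in ∈-filter⁺ P? x∈U Px)

count : ∀ {A : Set} {P : Pred A 0ℓ} → Decidable P → List A → ℕ
count P? xs = length (filter P? xs)

count-split : ∀ {A : Set} {P Q : Pred A 0ℓ} (P? : Decidable P) (Q? : Decidable Q) xs →
  count P? (filter Q? xs) + count P? (filter (∁? Q?) xs) ≡ count P? xs
count-split P? Q? [] = refl
count-split P? Q? (x ∷ xs) with does (Q? x)
... | true with does (P? x)
...   | true  = cong suc (count-split P? Q? xs)
...   | false = count-split P? Q? xs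
count-split P? Q? (x ∷ xs) | false with does (P? x)
...   | true  = trans (+-suc _ _) (cong suc (count-split P? Q? xs))
...   | false = count-split P? Q? xs

DownClosed : Pred ℕ 0ℓ → Set
DownClosed P = ∀ {a b} → a ≤ b → P b → P a

satisfies⇒inPrefix : ∀ {P} (P? : Decidable P) → DownClosed P → ∀ {xs} → Linked _<_ xs →
                     (i : Fin (length xs)) → P (lookup xs i) → toℕ i < count P? xs
satisfies⇒inPrefix P? down {x ∷ xs} s i Pxᵢ with P? x
satisfies⇒inPrefix P? down s fzero _ | yes _ = z<s
satisfies⇒inPrefix P? down s (fsuc i) Pxᵢ | yes _ = s<s (satisfies⇒inPrefix P? down (Linked.tail s) i Pxᵢ)
satisfies⇒inPrefix P? down s fzero Px | no ¬Px = contradiction Px ¬Px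
satisfies⇒inPrefix P? down s (fsuc i) Pxᵢ | no ¬Px =
  contradiction (down (<⇒≤ (All.lookup (head-below s) (∈-lookup i))) Pxᵢ) ¬Px

violates⇒outsidePrefix : ∀ {P} (P? : Decidable P) → DownClosed P → ∀ {xs} → Linked _<_ xs →
                         (i : Fin (length xs)) → ¬ P (lookup xs i) → count P? xs ≤ toℕ i
violates⇒outsidePrefix P? down {x ∷ xs} s i ¬Pxᵢ with P? x
violates⇒outsidePrefix P? down s fzero ¬Px | yes Px = contradiction Px ¬Px
violates⇒outsidePrefix P? down s (fsuc i) ¬Pxᵢ | yes _ =
  s≤s (violates⇒outsidePrefix P? down (Linked.tail s) i ¬Pxᵢ)
violates⇒outsidePrefix P? down {x ∷ xs} s i _ | no ¬Px = subst (_≤ toℕ i) (sym none) z≤n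
  where
  -- every later entry exceeds x, so none of them satisfies P either
  none : count P? xs ≡ 0
  none = cong length (filter-none P? (All.map (λ x<y Py → ¬Px (down (<⇒≤ x<y) Py)) (head-below s)))

countLE : ℕ → List ℕ → ℕ
countLE p = count (_≤? p)

≤-downClosed : ∀ p → DownClosed (_≤ p)
≤-downClosed p = ≤-trans

countLE≤length : ∀ p xs → countLE p xs ≤ length xs
countLE≤length p xs = length-filter (_≤? p) xs

countLE-all : ∀ {p xs} → All (_≤ p) xs → countLE p xs ≡ length xs
countLE-all {p} all = cong length (filter-all (_≤? p) all)

below⇒inPrefix : ∀ {p xs} → Linked _<_ xs → (i : Fin (length xs)) →
                 lookup xs i ≤ p → toℕ i < countLE p xs
below⇒inPrefix {p} = satisfies⇒inPrefix (_≤? p) (≤-downClosed p)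

above⇒outsidePrefix : ∀ {p xs} → Linked _<_ xs → (i : Fin (length xs)) →
                      p < lookup xs i → countLE p xs ≤ toℕ i
above⇒outsidePrefix {p} s i p<xᵢ = violates⇒outsidePrefix (_≤? p) (≤-downClosed p) s i (<⇒≱ p<xᵢ)

inPrefix⇒below : ∀ {p xs} → Linked _<_ xs → (i : Fin (length xs)) →
                 toℕ i < countLE p xs → lookup xs i ≤ p
inPrefix⇒below s i i<c = ≮⇒≥ (λ p<xᵢ → <⇒≱ i<c (above⇒outsidePrefix s i p<xᵢ))

outsidePrefix⇒above : ∀ {p xs} → Linked _<_ xs → (i : Fin (length xs)) →
                      countLE p xs ≤ toℕ i → p < lookup xs i
outsidePrefix⇒above s i c≤i = ≰⇒> (λ xᵢ≤p → <⇒≱ (below⇒inPrefix s i xᵢ≤p) c≤i)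

opposite-span : ∀ {ℓ} (i : Fin ℓ) → suc (toℕ i + toℕ (opposite i)) ≡ ℓ
opposite-span i = trans (cong (λ t → suc (toℕ i + t)) (opposite-prop i)) (m+[n∸m]≡n (toℕ<n i))

mirror-budget⁺ : ∀ {ℓ x} (i : Fin ℓ) → x ≤ toℕ (opposite i) → suc (toℕ i) + x ≤ ℓ
mirror-budget⁺ i x≤ = ≤-trans (s≤s (+-monoʳ-≤ (toℕ i) x≤)) (≤-reflexive (opposite-span i))

mirror-budget⁻ : ∀ {ℓ x} (i : Fin ℓ) → suc (toℕ i) + x ≤ ℓ → x ≤ toℕ (opposite i)
mirror-budget⁻ {x = x} i fits =
  +-cancelˡ-≤ (suc (toℕ i)) x _ (≤-trans fits (≤-reflexive (sym (opposite-span i))))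

PairSumsAtLeast PairSumsAtMost : ℕ → List ℕ → Set
PairSumsAtLeast n A = (i : Fin (length A)) → n ≤ lookup A i + lookup A (opposite i)
PairSumsAtMost  n A = (i : Fin (length A)) → lookup A i + lookup A (opposite i) ≤ n

GCount LCount : ℕ → List ℕ → Set
GCount j A = ∀ p q → p + q ≡ j → countLE p A + countLE q A ≤ length A
LCount j A = ∀ p q → p + q ≡ j → length A ≤ countLE p A + countLE q A

module _ {p q j : ℕ} (p+q≡j : p + q ≡ j) where
  open ≤-Reasoning

  partner-above : ∀ {a b} → a ≤ p → suc j ≤ a + b → q < b
  partner-above {a} {b} a≤p n≤a+b = +-cancelˡ-≤ p (suc q) b (begin
    p + suc q    ≡⟨ +-suc p q ⟩
    suc (p + q)  ≡⟨ cong suc p+q≡j ⟩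
    suc j        ≤⟨ n≤a+b ⟩
    a + b        ≤⟨ +-monoˡ-≤ b a≤p ⟩
    p + b        ∎)

  sum-reaches : ∀ {b} → q < b → suc j ≤ p + b
  sum-reaches {b} q<b = begin
    suc j        ≡⟨ cong suc p+q≡j ⟨
    suc (p + q)  ≡⟨ +-suc p q ⟨
    p + suc q    ≤⟨ +-monoʳ-≤ p q<b ⟩
    p + b        ∎

  sum-exceeds : ∀ {a b} → q < a → p < b → suc j < a + b
  sum-exceeds {a} {b} q<a p<b = begin-strict
    suc j              ≡⟨ cong suc p+q≡j ⟨
    suc (p + q)        <⟨ n<1+n _ ⟩
    suc (suc (p + q))  ≡⟨ cong suc (+-suc p q) ⟨
    suc p + suc q      ≤⟨ +-mono-≤ p<b q<a ⟩
    b + a              ≡⟨ +-comm b a ⟩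
    a + b              ∎

split-excess : ∀ {a b j} → a ≤ j → b ≤ j → suc j < a + b →
               ∃₂ λ p q → p + q ≡ j × q < a × p < b
split-excess {zero} {b} {j} _ b≤j n<b = contradiction (<-trans (n<1+n j) n<b) (≤⇒≯ b≤j)
split-excess {suc q} {b} {j} a≤j _ n<a+b = j ∸ q , q , m∸n+n≡m q≤j , n<1+n q , j∸q<b
  where
  q≤j : q ≤ j
  q≤j = <⇒≤ a≤j
  j∸q<b : j ∸ q < b
  j∸q<b = +-cancelˡ-< q (j ∸ q) b (subst (_< q + b) (sym (m+[n∸m]≡n q≤j)) (s<s⁻¹ n<a+b))

-- G-pairing ⇒ G-counting: the last entry ≤ p sits at position i = countLE p − 1, its
-- mirror partner exceeds q, so the entries ≤ q fit in the toℕ (opposite i) slots after i.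
pairs⇒GCount : ∀ {j A} → Linked _<_ A → PairSumsAtLeast (suc j) A → GCount j A
pairs⇒GCount {j} {A} sorted pairs p q p+q≡j with countLE p A in cp≡ | countLE≤length p A
... | zero  | _      = countLE≤length q A
... | suc k | k<ℓ = subst (λ t → suc t + countLE q A ≤ length A) i≡k (mirror-budget⁺ i cq≤i*)
  where
  i : Fin (length A)
  i = fromℕ< k<ℓ
  i≡k : toℕ i ≡ k
  i≡k = toℕ-fromℕ< k<ℓ
  aᵢ≤p : lookup A i ≤ p
  aᵢ≤p = inPrefix⇒below sorted i (subst₂ _<_ (sym i≡k) (sym cp≡) (n<1+n k))
  cq≤i* : countLE q A ≤ toℕ (opposite i)
  cq≤i* = above⇒outsidePrefix sorted (opposite i) (partner-above p+q≡j aᵢ≤p (pairs i))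

-- G-counting ⇒ G-pairing: take p = aᵢ, q = j − aᵢ; at least i + 1 entries are ≤ p,
-- so at most toℕ (opposite i) entries are ≤ q, hence the mirror partner exceeds q.
GCount⇒pairs : ∀ {j A} → Linked _<_ A → All (_≤ j) A → GCount j A → PairSumsAtLeast (suc j) A
GCount⇒pairs {j} {A} sorted bounded counting i = sum-reaches p+q≡j (outsidePrefix⇒above sorted (opposite i) cq≤i*)
  where
  p q : ℕ
  p = lookup A i
  q = j ∸ p
  p+q≡j : p + q ≡ j
  p+q≡j = m+[n∸m]≡n (All.lookup bounded (∈-lookup i))
  cq≤i* : countLE q A ≤ toℕ (opposite i)
  cq≤i* = mirror-budget⁻ i (≤-trans (+-monoˡ-≤ (countLE q A) (below⇒inPrefix sorted i ≤-refl)) (counting p q p+q≡j))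

-- L-pairing ⇒ L-counting: if countLE p + countLE q < |A|, the first entry above q
-- (position countLE q) and its mirror partner (above p) would sum past n.
pairs⇒LCount : ∀ {j A} → Linked _<_ A → PairSumsAtMost (suc j) A → LCount j A
pairs⇒LCount {j} {A} sorted pairs p q p+q≡j with length A ≤? countLE p A + countLE q A
... | yes fits = fits
... | no ¬fits = contradiction (pairs i) (<⇒≱ (sum-exceeds p+q≡j q<aᵢ p<aᵢ*))
  where
  short : countLE p A + countLE q A < length A
  short = ≰⇒> ¬fits
  cq<ℓ : countLE q A < length A
  cq<ℓ = ≤-<-trans (m≤n+m (countLE q A) (countLE p A)) short
  i : Fin (length A)
  i = fromℕ< cq<ℓ
  i≡cq : toℕ i ≡ countLE q A
  i≡cq = toℕ-fromℕ< cq<ℓ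
  q<aᵢ : q < lookup A i
  q<aᵢ = outsidePrefix⇒above sorted i (≤-reflexive (sym i≡cq))
  cp≤i* : countLE p A ≤ toℕ (opposite i)
  cp≤i* = mirror-budget⁻ i (subst (λ t → suc t + countLE p A ≤ length A) (sym i≡cq)
                              (subst (_< length A) (+-comm (countLE p A) (countLE q A)) short))
  p<aᵢ* : p < lookup A (opposite i)
  p<aᵢ* = outsidePrefix⇒above sorted (opposite i) cp≤i*

-- L-counting ⇒ L-pairing: if aᵢ + aᵢ* > n, split j = p + q with aᵢ > q and aᵢ* > p;
-- then at most i entries are ≤ q and at most toℕ (opposite i) are ≤ p, too few in total.
LCount⇒pairs : ∀ {j A} → Linked _<_ A → All (_≤ j) A → LCount j A → PairSumsAtMost (suc j) A
LCount⇒pairs {j} {A} sorted bounded counting i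
  with lookup A i + lookup A (opposite i) ≤? suc j
... | yes ok = ok
... | no ¬ok with split-excess (All.lookup bounded (∈-lookup i)) (All.lookup bounded (∈-lookup (opposite i))) (≰⇒> ¬ok)
...   | p , q , p+q≡j , q<aᵢ , p<aᵢ* = contradiction (counting p q p+q≡j) (<⇒≱ too-few)
  where
  too-few : countLE p A + countLE q A < length A
  too-few = begin-strict
    countLE p A + countLE q A     ≤⟨ +-monoʳ-≤ (countLE p A) (above⇒outsidePrefix sorted i q<aᵢ) ⟩
    countLE p A + toℕ i           ≡⟨ +-comm (countLE p A) (toℕ i) ⟩
    toℕ i + countLE p A           <⟨ n<1+n _ ⟩
    suc (toℕ i) + countLE p A     ≤⟨ mirror-budget⁺ i (above⇒outsidePrefix sorted (opposite i) p<aᵢ*) ⟩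
    length A                      ∎
    where open ≤-Reasoning

range-applyUpTo : ∀ j → range (suc j) ≡ applyUpTo suc j
range-applyUpTo j = map-upTo suc j

applyUpTo-sorted : ∀ (f : ℕ → ℕ) → (∀ i → f i < f (suc i)) → ∀ k → Linked _<_ (applyUpTo f k)
applyUpTo-sorted f inc zero = []
applyUpTo-sorted f inc (suc zero) = [-]
applyUpTo-sorted f inc (suc (suc k)) = inc 0 ∷ applyUpTo-sorted (λ i → f (suc i)) (λ i → inc (suc i)) (suc k)

interval-sorted : ∀ j → Linked _<_ (applyUpTo suc j)
interval-sorted = applyUpTo-sorted suc (λ i → n<1+n (suc i))

range-sorted : ∀ j → Linked _<_ (range (suc j))
range-sorted j = subst (Linked _<_) (sym (range-applyUpTo j)) (interval-sorted j)

range-bounds : ∀ j → All (λ x → 1 ≤ x × x < suc j) (range (suc j))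
range-bounds j = subst (All _) (sym (range-applyUpTo j)) (All.applyUpTo⁺₁ suc j (λ i<j → s≤s z≤n , s<s i<j))

range-∋ : ∀ {j x} → 1 ≤ x → x < suc j → x ∈ range (suc j)
range-∋ {j} {suc i} (s≤s z≤n) (s≤s i<j) = subst (suc i ∈_) (sym (range-applyUpTo j)) (∈-applyUpTo⁺ suc i<j)

-- {1,…,j} has exactly p members ≤ p when p ≤ j: its entry at position k is k + 1,
-- so by the initial-segment property countLE p can be neither below nor above p.
countLE-interval : ∀ {j p} → p ≤ j → countLE p (applyUpTo suc j) ≡ p
countLE-interval {j} {p} p≤j = ≤-antisym (≮⇒≥ too-many) (≮⇒≥ too-few)
  where
  U : List ℕ
  U = applyUpTo suc j
  c : ℕ
  c = countLE p U
  entry : ∀ {k} (k<ℓ : k < length U) → lookup U (fromℕ< k<ℓ) ≡ suc k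
  entry k<ℓ = trans (lookup-applyUpTo suc j _) (cong suc (toℕ-fromℕ< k<ℓ))
  too-many : ¬ p < c
  too-many p<c = <⇒≱ p<c (subst (c ≤_) (toℕ-fromℕ< p<ℓ)
                   (above⇒outsidePrefix (interval-sorted j) i (subst (p <_) (sym (entry p<ℓ)) (n<1+n p))))
    where
    p<ℓ : p < length U
    p<ℓ = <-≤-trans p<c (countLE≤length p U)
    i : Fin (length U)
    i = fromℕ< p<ℓ
  too-few : ¬ c < p
  too-few c<p = <-irrefl (toℕ-fromℕ< c<ℓ)
                  (below⇒inPrefix (interval-sorted j) i (subst (_≤ p) (sym (entry c<ℓ)) c<p))
    where
    c<ℓ : c < length U
    c<ℓ = <-≤-trans c<p (subst (p ≤_) (sym (length-applyUpTo suc j)) p≤j)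
    i : Fin (length U)
    i = fromℕ< c<ℓ

countLE-range : ∀ {j p} → p ≤ j → countLE p (range (suc j)) ≡ p
countLE-range {j} {p} p≤j = trans (cong (countLE p) (range-applyUpTo j)) (countLE-interval p≤j)

upper-bounds : ∀ {j A} → IsSubsetOf[n-1] (suc j) A → All (_≤ j) A
upper-bounds (_ , bounds) = All.map (λ bound → s≤s⁻¹ (proj₂ bound)) bounds

⊆range : ∀ {j A x} → IsSubsetOf[n-1] (suc j) A → x ∈ A → x ∈ range (suc j)
⊆range (_ , bounds) x∈A = let (1≤x , x<n) = All.lookup bounds x∈A in range-∋ 1≤x x<n

compl-subset : ∀ j A → IsSubsetOf[n-1] (suc j) (compl (suc j) A)
compl-subset j A = Linked.filter⁺ (_∉? A) <-trans (range-sorted j) , All.filter⁺ (_∉? A) (range-bounds j)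

filter-∈ : ∀ {j A} → IsSubsetOf[n-1] (suc j) A → filter (_∈? A) (range (suc j)) ≡ A
filter-∈ {j} {A} subA = filter-characterisation (_∈? A) (range-sorted j) (proj₁ subA)
  (λ x∈A → ⊆range subA x∈A , x∈A) (λ _ x∈A → x∈A)

compl-involutive : ∀ {j A} → IsSubsetOf[n-1] (suc j) A → compl (suc j) (compl (suc j) A) ≡ A
compl-involutive {j} {A} subA = filter-characterisation (_∉? C) (range-sorted j) (proj₁ subA)
  (λ x∈A → ⊆range subA x∈A , λ x∈C → proj₂ (∈-filter⁻ (_∉? A) {xs = range (suc j)} x∈C) x∈A)
  back
  where
  C : List ℕ
  C = compl (suc j) A
  back : ∀ {x} → x ∈ range (suc j) → x ∉ C → x ∈ A
  back {x} x∈U x∉C with x ∈? A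
  ... | yes x∈A = x∈A
  ... | no x∉A = contradiction (∈-filter⁺ (_∉? A) x∈U x∉A) x∉C

-- X and Y split {1,…,j} as far as threshold counts and sizes can tell.
record Complementary (j : ℕ) (X Y : List ℕ) : Set where
  field
    counts : ∀ p → p ≤ j → countLE p X + countLE p Y ≡ p
    sizes  : length X + length Y ≡ j

complementary-sym : ∀ {j X Y} → Complementary j X Y → Complementary j Y X
complementary-sym {X = X} {Y} c = record
  { counts = λ p p≤j → trans (+-comm (countLE p Y) (countLE p X)) (counts p p≤j)
  ; sizes  = trans (+-comm (length Y) (length X)) sizes
  }
  where open Complementary c

compl-complementary : ∀ {j A} → IsSubsetOf[n-1] (suc j) A → Complementary j A (compl (suc j) A)
compl-complementary {j} {A} subA = record { counts = counts ; sizes = sizes }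
  where
  open ≡-Reasoning
  C : List ℕ
  C = compl (suc j) A
  counts : ∀ p → p ≤ j → countLE p A + countLE p C ≡ p
  counts p p≤j = begin
    countLE p A + countLE p C
      ≡⟨ cong (λ X → countLE p X + countLE p C) (filter-∈ subA) ⟨
    countLE p (filter (_∈? A) (range (suc j))) + countLE p (filter (_∉? A) (range (suc j)))
      ≡⟨ count-split (_≤? p) (_∈? A) (range (suc j)) ⟩
    countLE p (range (suc j))
      ≡⟨ countLE-range p≤j ⟩
    p ∎
  sizes : length A + length C ≡ j
  sizes = begin
    length A + length C
      ≡⟨ cong₂ _+_ (countLE-all (upper-bounds subA)) (countLE-all (upper-bounds (compl-subset j A))) ⟨
    countLE j A + countLE j C
      ≡⟨ counts j ≤-refl ⟩
    j ∎

balance : ∀ {x y u v} → x + y ≡ u + v → x ≤ u → v ≤ y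
balance {x} {y} {u} {v} x+y≡u+v x≤u = +-cancelˡ-≤ u v y (begin
  u + v  ≡⟨ x+y≡u+v ⟨
  x + y  ≤⟨ +-monoˡ-≤ y x≤u ⟩
  u + y  ∎)
  where open ≤-Reasoning

count-total : ∀ {j X Y p q} → Complementary j X Y → p + q ≡ j →
  (countLE p X + countLE q X) + (countLE p Y + countLE q Y) ≡ length X + length Y
count-total {j} {X} {Y} {p} {q} c p+q≡j = begin
  (countLE p X + countLE q X) + (countLE p Y + countLE q Y)
    ≡⟨ interchange (countLE p X) (countLE q X) (countLE p Y) (countLE q Y) ⟩
  (countLE p X + countLE p Y) + (countLE q X + countLE q Y)
    ≡⟨ cong₂ _+_ (counts p (subst (p ≤_) p+q≡j (m≤m+n p q))) (counts q (subst (q ≤_) p+q≡j (m≤n+m q p))) ⟩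
  p + q
    ≡⟨ trans p+q≡j (sym sizes) ⟩
  length X + length Y ∎
  where
  open ≡-Reasoning
  open Complementary c

GCount⇒LCount : ∀ {j X Y} → Complementary j X Y → GCount j X → LCount j Y
GCount⇒LCount c g p q p+q≡j = balance (count-total {p = p} {q} c p+q≡j) (g p q p+q≡j)

LCount⇒GCount : ∀ {j X Y} → Complementary j X Y → LCount j Y → GCount j X
LCount⇒GCount {X = X} {Y} c l p q p+q≡j = balance swapped (l p q p+q≡j)
  where
  swapped : length Y + length X ≡ (countLE p Y + countLE q Y) + (countLE p X + countLE q X)
  swapped = trans (+-comm (length Y) (length X))
              (trans (sym (count-total {p = p} {q} c p+q≡j))
                     (+-comm (countLE p X + countLE q X) (countLE p Y + countLE q Y)))

lemma4p13 : (n : ℕ) → 1 ≤ n →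
    ((A : List ℕ) → InG n A → InL n (compl n A))
    × ((A B : List ℕ) → InG n A → InG n B → compl n A ≡ compl n B → A ≡ B)
    × ((B : List ℕ) → InL n B → ∃ (λ A → InG n A × compl n A ≡ B))
lemma4p13 zero ()
lemma4p13 (suc j) _ = well-defined , injective , surjective
  where
  well-defined : (A : List ℕ) → InG (suc j) A → InL (suc j) (compl (suc j) A)
  well-defined A (subA , pairsA) = subC ,
    LCount⇒pairs (proj₁ subC) (upper-bounds subC)
      (GCount⇒LCount (compl-complementary subA) (pairs⇒GCount (proj₁ subA) pairsA))
    where
    subC : IsSubsetOf[n-1] (suc j) (compl (suc j) A)
    subC = compl-subset j A
  injective : (A B : List ℕ) → InG (suc j) A → InG (suc j) B → compl (suc j) A ≡ compl (suc j) B → A ≡ B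
  injective A B (subA , _) (subB , _) fA≡fB = begin
    A                              ≡⟨ compl-involutive subA ⟨
    compl (suc j) (compl (suc j) A) ≡⟨ cong (compl (suc j)) fA≡fB ⟩
    compl (suc j) (compl (suc j) B) ≡⟨ compl-involutive subB ⟩
    B                              ∎
    where open ≡-Reasoning
  surjective : (B : List ℕ) → InL (suc j) B → ∃ (λ A → InG (suc j) A × compl (suc j) A ≡ B)
  surjective B (subB , pairsB) = compl (suc j) B ,
    (subC , GCount⇒pairs (proj₁ subC) (upper-bounds subC)
              (LCount⇒GCount (complementary-sym (compl-complementary subB)) (pairs⇒LCount (proj₁ subB) pairsB))) ,
    compl-involutive subB
    where
    subC : IsSubsetOf[n-1] (suc j) (compl (suc j) B)
    subC = compl-subset j B
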